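{- Let $n\ge 3$ and $a\ge 1$ be integers. (i) Every power of a cycle $C^a_n$ is a TRVG. (ii) $D^1_n$ is a TRVG. (iii) If $a\ge 3$ and $n\ge 2a+8$, then $D^a_n$ is not a TRVG. (iv) If $a\ge 2$ and $n\le 2a+4$, then $D^a_n$ is a TRVG.
   Context: A graph $G$ is a transparent rectangle visibility graph (TRVG) if there is a collection of rectangles in the plane with sides parallel to the coordinate axes and pairwise disjoint interiors, one rectangle $R_v$ for each vertex $v$, such that for distinct vertices $u,v$: $u$ and $v$ are adjacent if and only if there is a horizontal or a vertical line meeting the interiors of both $R_u$ and $R_v$ (other rectangles in between do not block visibility). For integers $n\ge 3$, $a\ge 1$, the $a$-th power of the cycle, $C^a_n$, has vertices $v_1,\dots,v_n$, with distinct $v_i,v_j$ adjacent iff $|i-j|\equiv \pm k \pmod n$ for some $k\in\{1,\dots,a\}$ (i.e. their cyclic distance is at most $a$). $D^a_n$ denotes the complement of $C^a_n$.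
   Formalization: The rectangles have rational coordinates, and the horizontal and vertical lines and the interior points are taken over ℚ. -}

module Defs where

open import Data.Nat using (ℕ; _+_; _*_; _≤_)
open import Data.Fin using (Fin; toℕ)
open import Data.Rational using (ℚ; _<_)
open import Data.Product using (Σ; _×_; ∃; ∃-syntax)
open import Data.Sum using (_⊎_)
open import Relation.Binary.PropositionalEquality using (_≡_; _≢_)
open import Relation.Nullary using (¬_)

Graph : ℕ → Set₁
Graph n = Fin n → Fin n → Set

record Rect : Set where
  constructor rect
  field
    x₁ x₂ y₁ y₂ : ℚ

open Rect public

ProperRect : Rect → Set
ProperRect r = (x₁ r < x₂ r) × (y₁ r < y₂ r)

InOpen : ℚ → ℚ → ℚ → Set
InOpen c lo hi = (lo < c) × (c < hi)

InInterior : ℚ → ℚ → Rect → Set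
InInterior x y r = InOpen x (x₁ r) (x₂ r) × InOpen y (y₁ r) (y₂ r)

DisjointInteriors : Rect → Rect → Set
DisjointInteriors r s = ¬ (∃[ x ] ∃[ y ] (InInterior x y r × InInterior x y s))

-- some horizontal line y = c meets the interiors of both rectangles
HorizVisible : Rect → Rect → Set
HorizVisible r s = ∃[ c ] (InOpen c (y₁ r) (y₂ r) × InOpen c (y₁ s) (y₂ s))

VertVisible : Rect → Rect → Set
VertVisible r s = ∃[ c ] (InOpen c (x₁ r) (x₂ r) × InOpen c (x₁ s) (x₂ s))

Visible : Rect → Rect → Set
Visible r s = HorizVisible r s ⊎ VertVisible r s

IsTRVG : {n : ℕ} → Graph n → Set
IsTRVG {n} G =
  Σ (Fin n → Rect) λ R →
      (∀ v → ProperRect (R v))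
    × (∀ u v → u ≢ v → DisjointInteriors (R u) (R v))
    × (∀ u v → u ≢ v → (G u v → Visible (R u) (R v)) × (Visible (R u) (R v) → G u v))

-- Powers of cycles.  Vertex v_{i+1} is represented by i : Fin n.
-- v_i, v_j adjacent iff distinct and j ≡ i ± k (mod n) for some 1 ≤ k ≤ a.

-- x ≡ y (mod n), for y < n: x = y + m·n for some m
CongMod : ℕ → ℕ → ℕ → Set
CongMod n x y = ∃[ m ] (x ≡ y + m * n)

CycPow : (n a : ℕ) → Graph n
CycPow n a u v =
  (u ≢ v) ×
  ∃[ k ] ((1 ≤ k) × (k ≤ a) ×
          (CongMod n (toℕ u + k) (toℕ v) ⊎ CongMod n (toℕ v + k) (toℕ u)))

CycPowCompl : (n a : ℕ) → Graph n
CycPowCompl n a u v = (u ≢ v) × ¬ CycPow n a u v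

{-# OPTIONS --safe #-}
module Submission where

-- A graph is a TRVG as soon as its edges are the pairs whose intervals overlap in one of two
-- interval families on the vertices, never in both: vertex v becomes the product of its two
-- intervals, and "never in both" is exactly the disjointness of the interiors. Such families are
-- written down for C^a_n, for D^1_n (splitting the edges by the parity of their smaller end) and
-- for D^a_n with n ≤ 2a + 4 (whose edges join vertices at distance a + 1, a + 2 or a + 3).
--
-- Conversely, in a TRVG an induced K_{p,q} has fewer than 2(p + q) edges. Charge each edge to an
-- axis along which its two rectangles are visible and to the one whose extent along that axis ends
-- first. A rectangle charged twice on one axis would make its two partners see each other, and the
-- rectangle whose x-extent ends last is never charged on the x-axis. For a ≥ 3 and n ≥ 2a + 8 the
-- vertices 0, …, 3 and a + 4, …, a + 7 induce K₄,₄ in D^a_n, and 4 · 4 = 2 (4 + 4).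

open import Defs
open import Data.Nat as ℕ using (ℕ; zero; suc; _+_; _*_; _∸_; _<_; _≤_; _<?_; _≤?_; z≤n; s≤s; s≤s⁻¹; parity)
import Data.Nat.Properties as ℕ
open import Data.Nat.Tactic.RingSolver using (solve-∀)
import Data.Integer as ℤ
import Data.Integer.Properties as ℤ
open import Data.Rational as ℚ using (ℚ)
import Data.Rational.Properties as ℚ
open import Data.Rational.Literals using (fromℤ)
open import Data.Parity.Base using (0ℙ; 1ℙ)
open import Data.Parity.Properties using (suc-homo-⁻¹; p≢p⁻¹)
open import Data.Fin as Fin using (Fin; zero; suc; toℕ; fromℕ<; combine; remQuot; join; splitAt; punchOut)
import Data.Fin.Properties as Fin
open import Data.List.Base using (allFin)
open import Relation.Binary.Bundles using (DecTotalOrder)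
open import Data.List.Extrema (DecTotalOrder.totalOrder ℚ.≤-decTotalOrder) using (argmax; f[xs]≤f[argmax])
import Data.List.Relation.Unary.All as All
open import Data.List.Membership.Propositional.Properties using (∈-allFin)
open import Data.Product using (_×_; _,_; proj₁; proj₂; ∃; ∃-syntax; uncurry)
open import Data.Sum using (_⊎_; inj₁; inj₂; swap)
open import Data.Sum.Function.Propositional using (_⊎-⇔_)
open import Data.Unit using (⊤; tt)
open import Data.Empty using (⊥; ⊥-elim)
open import Function using (_∘_; const)
open import Function.Bundles using (_⇔_; mk⇔; Equivalence)
import Function.Properties.Equivalence as ⇔
open import Relation.Nullary using (¬_; yes; no)
open import Relation.Binary.Definitions using (tri<; tri≈; tri>)
open import Relation.Binary.PropositionalEquality using (_≡_; _≢_; refl; sym; trans; cong; cong₂; subst; subst₂)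

open Equivalence using (to; from)
open ℕ.≤-Reasoning

-- Graphs from two interval families

record Interval : Set where
  constructor [_,_]
  field
    lower upper : ℕ

open Interval

Proper : Interval → Set
Proper I = lower I < upper I

Overlap : Interval → Interval → Set
Overlap I J = lower I < upper J × lower J < upper I

overlap-sym : ∀ {I J} → Overlap I J → Overlap J I
overlap-sym (p , q) = q , p

ι : ℕ → ℚ
ι n = fromℤ (ℤ.+ n)

ι-mono-< : ∀ {m n} → m < n → ι m ℚ.< ι n
ι-mono-< {m} {n} m<n =
  ℚ.*<* (subst₂ ℤ._<_ (sym (ℤ.*-identityʳ (ℤ.+ m))) (sym (ℤ.*-identityʳ (ℤ.+ n))) (ℤ.+<+ m<n))

ι-mono-≤ : ∀ {m n} → m ≤ n → ι m ℚ.≤ ι n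
ι-mono-≤ {m} {n} m≤n =
  ℚ.*≤* (subst₂ ℤ._≤_ (sym (ℤ.*-identityʳ (ℤ.+ m))) (sym (ℤ.*-identityʳ (ℤ.+ n))) (ℤ.+≤+ m≤n))

ι-cancel-< : ∀ {m n} → ι m ℚ.< ι n → m < n
ι-cancel-< {m} {n} (ℚ.*<* p) =
  ℤ.drop‿+<+ (subst₂ ℤ._<_ (ℤ.*-identityʳ (ℤ.+ m)) (ℤ.*-identityʳ (ℤ.+ n)) p)

Meet : ℚ → ℚ → ℚ → ℚ → Set
Meet a b c d = ∃[ z ] (InOpen z a b × InOpen z c d)

meet⇔overlap : ∀ {I J} → Proper I → Proper J →
               Meet (ι (lower I)) (ι (upper I)) (ι (lower J)) (ι (upper J)) ⇔ Overlap I J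
meet⇔overlap {I} {J} I-proper J-proper = mk⇔ common⇒overlap overlap⇒common
  where
  common⇒overlap : Meet (ι (lower I)) (ι (upper I)) (ι (lower J)) (ι (upper J)) → Overlap I J
  common⇒overlap (z , (lI<z , z<uI) , (lJ<z , z<uJ)) =
    ι-cancel-< (ℚ.<-trans lI<z z<uJ) , ι-cancel-< (ℚ.<-trans lJ<z z<uI)

  overlap⇒common : Overlap I J → Meet (ι (lower I)) (ι (upper I)) (ι (lower J)) (ι (upper J))
  overlap⇒common (lI<uJ , lJ<uI)
    with ℚ.<-dense (ι-mono-< (ℕ.⊓-glb (ℕ.⊔-lub I-proper lJ<uI) (ℕ.⊔-lub lI<uJ J-proper)))
  ... | z , l<z , z<u =
    z , (ℚ.≤-<-trans (ι-mono-≤ (ℕ.m≤m⊔n _ _)) l<z , ℚ.<-≤-trans z<u (ι-mono-≤ (ℕ.m⊓n≤m _ _))) ,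
        (ℚ.≤-<-trans (ι-mono-≤ (ℕ.m≤n⊔m _ _)) l<z , ℚ.<-≤-trans z<u (ι-mono-≤ (ℕ.m⊓n≤n _ _)))

record Representation (n : ℕ) (R : ℕ → ℕ → Set) : Set where
  field
    extent   : ℕ → Interval
    proper   : ∀ {x} → x < n → Proper (extent x)
    overlap⇔ : ∀ {x y} → x < y → y < n → Overlap (extent x) (extent y) ⇔ R x y

wlog-< : ∀ {n} {P : Fin n → Fin n → Set} → (∀ {u v} → P u v → P v u) →
         (∀ {u v} → toℕ u < toℕ v → P u v) → ∀ {u v} → u ≢ v → P u v
wlog-< P-sym P-< {u} {v} u≢v with ℕ.<-cmp (toℕ u) (toℕ v)
... | tri< u<v _ _ = P-< u<v
... | tri≈ _ u≡v _ = ⊥-elim (u≢v (Fin.toℕ-injective u≡v))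
... | tri> _ _ v<u = P-sym (P-< v<u)

module _ {n} {R S : ℕ → ℕ → Set} (ρ : Representation n R) (σ : Representation n S)
         (R∩S=∅ : ∀ {x y} → x < y → y < n → R x y → S x y → ⊥) where

  private
    module ρ = Representation ρ
    module σ = Representation σ

    -- ρ gives the y-extents, so that ρ-overlaps are the horizontal visibilities
    rectangle : Fin n → Rect
    rectangle v = rect (ι (lower X)) (ι (upper X)) (ι (lower Y)) (ι (upper Y))
      where
      X = σ.extent (toℕ v)
      Y = ρ.extent (toℕ v)

    horizontal⇔ρ-overlap : ∀ u v → HorizVisible (rectangle u) (rectangle v) ⇔
                                   Overlap (ρ.extent (toℕ u)) (ρ.extent (toℕ v))
    horizontal⇔ρ-overlap u v = meet⇔overlap (ρ.proper (Fin.toℕ<n u)) (ρ.proper (Fin.toℕ<n v))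

    vertical⇔σ-overlap : ∀ u v → VertVisible (rectangle u) (rectangle v) ⇔
                                 Overlap (σ.extent (toℕ u)) (σ.extent (toℕ v))
    vertical⇔σ-overlap u v = meet⇔overlap (σ.proper (Fin.toℕ<n u)) (σ.proper (Fin.toℕ<n v))

  representations⇒TRVG : {G : Graph n} {P : ℕ → ℕ → Set} → (∀ {u v} → G u v → G v u) →
                         (∀ {u v} → toℕ u < toℕ v → G u v ⇔ P (toℕ u) (toℕ v)) →
                         (∀ {x y} → x < y → y < n → P x y ⇔ (R x y ⊎ S x y)) →
                         IsTRVG G
  representations⇒TRVG {G} G-sym G⇔P P⇔R⊎S =
    rectangle , proper , (λ _ _ → wlog-< disjoint-sym disjoint) , (λ _ _ → visibility)
    where
    proper : ∀ v → ProperRect (rectangle v)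
    proper v = ι-mono-< (σ.proper (Fin.toℕ<n v)) , ι-mono-< (ρ.proper (Fin.toℕ<n v))

    disjoint-sym : ∀ {u v} → DisjointInteriors (rectangle u) (rectangle v) →
                   DisjointInteriors (rectangle v) (rectangle u)
    disjoint-sym disjoint (x , y , in-v , in-u) = disjoint (x , y , in-u , in-v)

    disjoint : ∀ {u v} → toℕ u < toℕ v → DisjointInteriors (rectangle u) (rectangle v)
    disjoint {u} {v} u<v (x , y , (xu , yu) , (xv , yv)) = R∩S=∅ u<v v<n
      (to (ρ.overlap⇔ u<v v<n) (to (horizontal⇔ρ-overlap u v) (y , yu , yv)))
      (to (σ.overlap⇔ u<v v<n) (to (vertical⇔σ-overlap u v) (x , xu , xv)))
      where
      v<n = Fin.toℕ<n v

    G⇔visible-sym : ∀ {u v} → G u v ⇔ Visible (rectangle u) (rectangle v) →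
                    G v u ⇔ Visible (rectangle v) (rectangle u)
    G⇔visible-sym G⇔visible =
      mk⇔ (visible-sym ∘ to G⇔visible ∘ G-sym) (G-sym ∘ from G⇔visible ∘ visible-sym)
      where
      visible-sym : ∀ {r s} → Visible r s → Visible s r
      visible-sym (inj₁ (z , p , q)) = inj₁ (z , q , p)
      visible-sym (inj₂ (z , p , q)) = inj₂ (z , q , p)

    G⇔visible : ∀ {u v} → toℕ u < toℕ v → G u v ⇔ Visible (rectangle u) (rectangle v)
    G⇔visible {u} {v} u<v = ⇔.trans (⇔.trans (G⇔P u<v) (P⇔R⊎S u<v v<n)) (⇔.sym (⇔.trans
      (horizontal⇔ρ-overlap u v ⊎-⇔ vertical⇔σ-overlap u v) (ρ.overlap⇔ u<v v<n ⊎-⇔ σ.overlap⇔ u<v v<n)))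
      where
      v<n = Fin.toℕ<n v

    visibility : ∀ {u v} → u ≢ v →
                 (G u v → Visible (rectangle u) (rectangle v)) × (Visible (rectangle u) (rectangle v) → G u v)
    visibility u≢v = to G⇔vis , from G⇔vis
      where
      G⇔vis = wlog-< G⇔visible-sym G⇔visible u≢v

-- Cyclic distance

-- For x < y < n: the cyclic distance of x and y is at most a, resp. more than a.
Near Far : ℕ → ℕ → ℕ → ℕ → Set
Near n a x y = y ≤ x + a ⊎ x + n ≤ y + a
Far n a x y = x + a < y × y + a < x + n

far⇒¬near : ∀ {n a x y} → Far n a x y → ¬ Near n a x y
far⇒¬near (x+a<y , _) (inj₁ y≤x+a) = ℕ.<⇒≱ x+a<y y≤x+a
far⇒¬near (_ , y+a<x+n) (inj₂ x+n≤y+a) = ℕ.<⇒≱ y+a<x+n x+n≤y+a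

¬near⇒far : ∀ {n a x y} → ¬ Near n a x y → Far n a x y
¬near⇒far ¬near = ℕ.≰⇒> (¬near ∘ inj₁) , ℕ.≰⇒> (¬near ∘ inj₂)

cycPow-sym : ∀ {n a u v} → CycPow n a u v → CycPow n a v u
cycPow-sym (u≢v , k , 1≤k , k≤a , congruent) = u≢v ∘ sym , k , 1≤k , k≤a , swap congruent

cycPowCompl-sym : ∀ {n a u v} → CycPowCompl n a u v → CycPowCompl n a v u
cycPowCompl-sym (u≢v , ¬adjacent) = u≢v ∘ sym , ¬adjacent ∘ cycPow-sym

module _ {n a x y : ℕ} (x<y : x < y) where

  forward-congruent⇒near : ∀ {k} m → x + k ≡ y + m * n → k ≤ a → Near n a x y
  forward-congruent⇒near {k} zero x+k≡y k≤a = inj₁ (begin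
    y      ≡⟨ sym (trans x+k≡y (ℕ.+-identityʳ y)) ⟩
    x + k  ≤⟨ ℕ.+-monoʳ-≤ x k≤a ⟩
    x + a  ∎)
  forward-congruent⇒near {k} (suc m) x+k≡y+n+mn k≤a = inj₂ (begin
    x + n            ≤⟨ ℕ.+-monoˡ-≤ n (ℕ.<⇒≤ x<y) ⟩
    y + n            ≤⟨ ℕ.+-monoʳ-≤ y (ℕ.m≤m+n n (m * n)) ⟩
    y + (n + m * n)  ≡⟨ sym x+k≡y+n+mn ⟩
    x + k            ≤⟨ ℕ.+-mono-≤ (ℕ.<⇒≤ x<y) k≤a ⟩
    y + a            ∎)

  backward-congruent⇒near : ∀ {k} m → y + k ≡ x + m * n → k ≤ a → Near n a x y
  backward-congruent⇒near {k} zero y+k≡x _ = ⊥-elim (ℕ.<⇒≱ x<y (begin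
    y      ≤⟨ ℕ.m≤m+n y k ⟩
    y + k  ≡⟨ trans y+k≡x (ℕ.+-identityʳ x) ⟩
    x      ∎))
  backward-congruent⇒near {k} (suc m) y+k≡x+n+mn k≤a = inj₂ (begin
    x + n            ≤⟨ ℕ.+-monoʳ-≤ x (ℕ.m≤m+n n (m * n)) ⟩
    x + (n + m * n)  ≡⟨ sym y+k≡x+n+mn ⟩
    y + k            ≤⟨ ℕ.+-monoʳ-≤ y k≤a ⟩
    y + a            ∎)

cycPow⇔near : ∀ {n a} {u v : Fin n} → toℕ u < toℕ v → CycPow n a u v ⇔ Near n a (toℕ u) (toℕ v)
cycPow⇔near {n} {a} {u} {v} u<v = mk⇔ cycPow⇒near near⇒cycPow
  where
  x = toℕ u
  y = toℕ v

  cycPow⇒near : CycPow n a u v → Near n a x y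
  cycPow⇒near (_ , k , _ , k≤a , inj₁ (m , x+k≡y+mn)) = forward-congruent⇒near u<v m x+k≡y+mn k≤a
  cycPow⇒near (_ , k , _ , k≤a , inj₂ (m , y+k≡x+mn)) = backward-congruent⇒near u<v m y+k≡x+mn k≤a

  u≢v : u ≢ v
  u≢v u≡v = ℕ.<-irrefl (cong toℕ u≡v) u<v

  near⇒cycPow : Near n a x y → CycPow n a u v
  near⇒cycPow (inj₁ y≤x+a) =
    u≢v , y ∸ x , ℕ.m<n⇒0<n∸m u<v , ℕ.m≤n+o⇒m∸n≤o y x y≤x+a ,
    inj₁ (0 , trans (ℕ.m+[n∸m]≡n (ℕ.<⇒≤ u<v)) (sym (ℕ.+-identityʳ y)))
  near⇒cycPow (inj₂ x+n≤y+a) =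
    u≢v , x + n ∸ y , ℕ.m<n⇒0<n∸m y<x+n , ℕ.m≤n+o⇒m∸n≤o (x + n) y x+n≤y+a ,
    inj₂ (1 , trans (ℕ.m+[n∸m]≡n (ℕ.<⇒≤ y<x+n)) (cong (x +_) (sym (ℕ.*-identityˡ n))))
    where
    y<x+n : y < x + n
    y<x+n = ℕ.<-≤-trans (Fin.toℕ<n v) (ℕ.m≤n+m n x)

cycPowCompl⇔far : ∀ {n a} {u v : Fin n} → toℕ u < toℕ v → CycPowCompl n a u v ⇔ Far n a (toℕ u) (toℕ v)
cycPowCompl⇔far u<v = mk⇔
  (λ (_ , ¬adjacent) → ¬near⇒far (¬adjacent ∘ from (cycPow⇔near u<v)))
  (λ far → (λ u≡v → ℕ.<-irrefl (cong toℕ u≡v) u<v) , far⇒¬near far ∘ to (cycPow⇔near u<v))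

cycPow-within : ∀ {n a} {u v : Fin n} → u ≢ v → toℕ v ≤ toℕ u + a → toℕ u ≤ toℕ v + a → CycPow n a u v
cycPow-within {n} {a} = wlog-< {P = λ u v → toℕ v ≤ toℕ u + a → toℕ u ≤ toℕ v + a → CycPow n a u v}
  (λ within v≤u+a u≤v+a → cycPow-sym (within u≤v+a v≤u+a))
  (λ u<v v≤u+a _ → from (cycPow⇔near u<v) (inj₁ v≤u+a))

module _ {n a : ℕ} {R S : ℕ → ℕ → Set} (ρ : Representation n R) (σ : Representation n S)
         (R∩S=∅ : ∀ {x y} → x < y → y < n → R x y → S x y → ⊥) where

  cycPow-representations⇒TRVG : (∀ {x y} → x < y → y < n → Near n a x y ⇔ (R x y ⊎ S x y)) →
                                IsTRVG (CycPow n a)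
  cycPow-representations⇒TRVG = representations⇒TRVG ρ σ R∩S=∅ cycPow-sym cycPow⇔near

  cycPowCompl-representations⇒TRVG : (∀ {x y} → x < y → y < n → Far n a x y ⇔ (R x y ⊎ S x y)) →
                                     IsTRVG (CycPowCompl n a)
  cycPowCompl-representations⇒TRVG = representations⇒TRVG ρ σ R∩S=∅ cycPowCompl-sym cycPowCompl⇔far

-- Intervals in quarter units

-- u ∙ c stands for the point u + c/4 (with c ≤ 3), scaled by 4.
infix 5 _∙_
_∙_ : ℕ → ℕ → ℕ
u ∙ c = c + u * 4

<⇒∙<∙ : ∀ {u v} c d → c ≤ 3 → u < v → u ∙ c < v ∙ d
<⇒∙<∙ {u} {v} c d c≤3 u<v = begin-strict
  c + u * 4    <⟨ s≤s (ℕ.+-monoˡ-≤ (u * 4) c≤3) ⟩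
  suc u * 4    ≤⟨ ℕ.*-monoˡ-≤ 4 u<v ⟩
  v * 4        ≤⟨ ℕ.m≤n+m (v * 4) d ⟩
  d + v * 4    ∎

≤⇒∙<∙ : ∀ {u v} c d → c < d → u ≤ v → u ∙ c < v ∙ d
≤⇒∙<∙ _ _ c<d u≤v = ℕ.+-mono-<-≤ c<d (ℕ.*-monoˡ-≤ 4 u≤v)

∙<∙⇒≤ : ∀ {u v} c d → d ≤ 3 → u ∙ c < v ∙ d → u ≤ v
∙<∙⇒≤ c d d≤3 u∙c<v∙d = ℕ.≮⇒≥ (λ v<u → ℕ.<-asym u∙c<v∙d (<⇒∙<∙ d c d≤3 v<u))

∙<∙⇒< : ∀ {u v} c d → d ≤ c → u ∙ c < v ∙ d → u < v
∙<∙⇒< _ _ d≤c u∙c<v∙d =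
  ℕ.≰⇒> (λ v≤u → ℕ.<⇒≱ u∙c<v∙d (ℕ.+-mono-≤ d≤c (ℕ.*-monoˡ-≤ 4 v≤u)))

unit : ℕ → ℕ → ℕ → Interval
unit p c d = [ p ∙ c , p ∙ d ]

point : ℕ → Interval
point p = unit p 0 1

gap : ℕ → ℕ → Interval
gap p q = [ p ∙ 2 , q ∙ 0 ]

unit-proper : ∀ {p c d} → c < d → Proper (unit p c d)
unit-proper {p} c<d = ℕ.+-monoˡ-< (p * 4) c<d

point-proper : ∀ p → Proper (point p)
point-proper p = unit-proper {p} (s≤s z≤n)

gap-proper : ∀ {p q} → p < q → Proper (gap p q)
gap-proper = <⇒∙<∙ 2 0 (s≤s (s≤s z≤n))

unit-overlap⇔ : ∀ {p p′ c c′ d d′} → d ≤ 3 → d′ ≤ 3 →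
                Overlap (unit p c d) (unit p′ c′ d′) ⇔ (p ≡ p′ × c < d′ × c′ < d)
unit-overlap⇔ {p} {p′} {c} {c′} {d} {d′} d≤3 d′≤3 = mk⇔ same-unit offsets⇒overlap
  where
  same-unit : Overlap (unit p c d) (unit p′ c′ d′) → p ≡ p′ × c < d′ × c′ < d
  same-unit (p∙c<p′∙d′ , p′∙c′<p∙d)
    with ℕ.≤-antisym (∙<∙⇒≤ {p} {p′} c d′ d′≤3 p∙c<p′∙d′)
                     (∙<∙⇒≤ {p′} {p} c′ d d≤3 p′∙c′<p∙d)
  ... | refl = refl , ℕ.+-cancelʳ-< (p * 4) c d′ p∙c<p′∙d′ , ℕ.+-cancelʳ-< (p * 4) c′ d p′∙c′<p∙d

  offsets⇒overlap : p ≡ p′ × c < d′ × c′ < d → Overlap (unit p c d) (unit p′ c′ d′)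
  offsets⇒overlap (refl , c<d′ , c′<d) = ℕ.+-monoˡ-< (p * 4) c<d′ , ℕ.+-monoˡ-< (p * 4) c′<d

point-overlap⇔ : ∀ {p q} → Overlap (point p) (point q) ⇔ p ≡ q
point-overlap⇔ {p} {q} = ⇔.trans (unit-overlap⇔ {p} {q} (s≤s z≤n) (s≤s z≤n))
  (mk⇔ (λ (p≡q , _) → p≡q) (λ p≡q → p≡q , s≤s z≤n , s≤s z≤n))

point-gap-overlap⇔ : ∀ {r p q} → Overlap (point r) (gap p q) ⇔ (p < r × r < q)
point-gap-overlap⇔ = mk⇔
  (λ (r∙0<q∙0 , p∙2<r∙1) → ∙<∙⇒< 2 1 (s≤s z≤n) p∙2<r∙1 , ∙<∙⇒< 0 0 z≤n r∙0<q∙0)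
  (λ (p<r , r<q) → <⇒∙<∙ 0 0 z≤n r<q , <⇒∙<∙ 2 1 (s≤s (s≤s z≤n)) p<r)

gap-point-overlap⇔ : ∀ {r p q} → Overlap (gap p q) (point r) ⇔ (p < r × r < q)
gap-point-overlap⇔ = ⇔.trans (mk⇔ overlap-sym overlap-sym) point-gap-overlap⇔

gap-overlap⇔ : ∀ {p q p′ q′} → Overlap (gap p q) (gap p′ q′) ⇔ (p < q′ × p′ < q)
gap-overlap⇔ = mk⇔
  (λ (p∙2<q′∙0 , p′∙2<q∙0) → ∙<∙⇒< 2 0 z≤n p∙2<q′∙0 , ∙<∙⇒< 2 0 z≤n p′∙2<q∙0)
  (λ (p<q′ , p′<q) → <⇒∙<∙ 2 0 (s≤s (s≤s z≤n)) p<q′ , <⇒∙<∙ 2 0 (s≤s (s≤s z≤n)) p′<q)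

points : ∀ {n} → Representation n (λ _ _ → ⊥)
points = record
  { extent   = point
  ; proper   = λ {x} _ → point-proper x
  ; overlap⇔ = λ x<y _ → mk⇔ (λ o → ℕ.<-irrefl (to point-overlap⇔ o) x<y) ⊥-elim
  }

stacked : ∀ {n} → Representation n (λ _ _ → ⊤)
stacked = record
  { extent   = const (point 0)
  ; proper   = const (point-proper 0)
  ; overlap⇔ = λ _ _ → mk⇔ (const tt) (const (from (point-overlap⇔ {0}) refl))
  }

-- Powers of cycles

cycPow-TRVG-≤2a : ∀ {n a} → n ≤ a + a → IsTRVG (CycPow n a)
cycPow-TRVG-≤2a {n} {a} n≤2a = cycPow-representations⇒TRVG stacked points (λ _ _ _ ())
  (λ x<y y<n → mk⇔ (const (inj₁ tt)) (const (near x<y)))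
  where
  near : ∀ {x y} → x < y → Near n a x y
  near {x} {y} x<y with y ≤? x + a
  ... | yes y≤x+a = inj₁ y≤x+a
  ... | no y≰x+a = inj₂ (begin
    x + n        ≤⟨ ℕ.+-monoʳ-≤ x n≤2a ⟩
    x + (a + a)  ≡⟨ sym (ℕ.+-assoc x a a) ⟩
    x + a + a    ≤⟨ ℕ.+-monoˡ-≤ a (ℕ.<⇒≤ (ℕ.≰⇒> y≰x+a)) ⟩
    y + a        ∎)

-- For 2a < n, Near n a is the disjoint union of these two relations.
NearLow : ℕ → ℕ → ℕ → Set
NearLow a x y = x < a × y ≤ x + a

NearHigh : ℕ → ℕ → ℕ → ℕ → Set
NearHigh n a x y = (x < a × a ≤ y × x + n ≤ y + a) ⊎ (a ≤ x × y ≤ x + a)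

-- A vertex x reaches its a successors in the first family if x < a, and in the second otherwise;
-- in the second family, x < a sits at x + n, within reach of its wrap-around neighbours.
lowReach : ℕ → ℕ → Interval
lowReach a x with x <? a
... | yes _ = gap x (suc (x + a))
... | no _  = point x

highReach : ℕ → ℕ → ℕ → Interval
highReach n a x with x <? a
... | yes _ = point (x + n)
... | no _  = gap x (suc (x + a))

reach-proper : ∀ {x a} → Proper (gap x (suc (x + a)))
reach-proper {x} {a} = gap-proper (s≤s (ℕ.m≤m+n x a))

lowReaches : ∀ {n a} → Representation n (NearLow a)
lowReaches {n} {a} = record
  { extent   = lowReach a
  ; proper   = λ {x} _ → proper x
  ; overlap⇔ = λ x<y _ → mk⇔ (reached x<y) (reaches x<y)
  }
  where
  proper : ∀ x → Proper (lowReach a x)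
  proper x with x <? a
  ... | yes _ = reach-proper {x} {a}
  ... | no _  = point-proper x

  reached : ∀ {x y} → x < y → Overlap (lowReach a x) (lowReach a y) → NearLow a x y
  reached {x} {y} x<y o with x <? a | y <? a
  ... | yes x<a | yes y<a = x<a , ℕ.<⇒≤ (ℕ.<-≤-trans y<a (ℕ.m≤n+m a x))
  ... | yes x<a | no _    = x<a , s≤s⁻¹ (proj₂ (to (gap-point-overlap⇔ {y} {x}) o))
  ... | no x≮a  | yes y<a = ⊥-elim (x≮a (ℕ.<-trans x<y y<a))
  ... | no _    | no _    = ⊥-elim (ℕ.<-irrefl (to (point-overlap⇔ {x} {y}) o) x<y)

  reaches : ∀ {x y} → x < y → NearLow a x y → Overlap (lowReach a x) (lowReach a y)
  reaches {x} {y} x<y (x<a , y≤x+a) with x <? a | y <? a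
  ... | no x≮a | _    = ⊥-elim (x≮a x<a)
  ... | yes _  | yes _ = from gap-overlap⇔ (s≤s (ℕ.≤-trans (ℕ.<⇒≤ x<y) (ℕ.m≤m+n y a)) , s≤s y≤x+a)
  ... | yes _  | no _  = from gap-point-overlap⇔ (x<y , s≤s y≤x+a)

highReaches : ∀ {n a} → Representation n (NearHigh n a)
highReaches {n} {a} = record
  { extent   = highReach n a
  ; proper   = λ {x} _ → proper x
  ; overlap⇔ = λ x<y y<n → mk⇔ (reached x<y) (reaches x<y y<n)
  }
  where
  proper : ∀ x → Proper (highReach n a x)
  proper x with x <? a
  ... | yes _ = point-proper (x + n)
  ... | no _  = reach-proper {x} {a}

  reached : ∀ {x y} → x < y → Overlap (highReach n a x) (highReach n a y) → NearHigh n a x y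
  reached {x} {y} x<y o with x <? a | y <? a
  ... | yes _   | yes _   = ⊥-elim (ℕ.<-irrefl (ℕ.+-cancelʳ-≡ n x y (to (point-overlap⇔ {x + n} {y + n}) o)) x<y)
  ... | yes x<a | no y≮a  = inj₁ (x<a , ℕ.≮⇒≥ y≮a , s≤s⁻¹ (proj₂ (to (point-gap-overlap⇔ {x + n} {y}) o)))
  ... | no x≮a  | yes y<a = ⊥-elim (x≮a (ℕ.<-trans x<y y<a))
  ... | no x≮a  | no _    =
    inj₂ (ℕ.≮⇒≥ x≮a , s≤s⁻¹ (proj₂ (to (gap-overlap⇔ {x} {suc (x + a)} {y} {suc (y + a)}) o)))

  reaches : ∀ {x y} → x < y → y < n → NearHigh n a x y → Overlap (highReach n a x) (highReach n a y)
  reaches {x} {y} x<y y<n s with x <? a | y <? a | s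
  ... | yes _   | yes y<a | inj₁ (_ , a≤y , _) = ⊥-elim (ℕ.<⇒≱ y<a a≤y)
  ... | yes _   | no _    | inj₁ (_ , _ , x+n≤y+a) =
    from point-gap-overlap⇔ (ℕ.<-≤-trans y<n (ℕ.m≤n+m n x) , s≤s x+n≤y+a)
  ... | no x≮a  | _       | inj₁ (x<a , _) = ⊥-elim (x≮a x<a)
  ... | yes x<a | _       | inj₂ (a≤x , _) = ⊥-elim (ℕ.<⇒≱ x<a a≤x)
  ... | no _    | yes y<a | inj₂ (a≤x , _) = ⊥-elim (ℕ.<⇒≱ (ℕ.<-trans x<y y<a) a≤x)
  ... | no _    | no _    | inj₂ (_ , y≤x+a) =
    from gap-overlap⇔ (s≤s (ℕ.≤-trans (ℕ.<⇒≤ x<y) (ℕ.m≤m+n y a)) , s≤s y≤x+a)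

cycPow-TRVG->2a : ∀ {n a} → a + a < n → IsTRVG (CycPow n a)
cycPow-TRVG->2a {n} {a} 2a<n =
  cycPow-representations⇒TRVG lowReaches highReaches disjoint
    (λ x<y y<n → mk⇔ (split x<y y<n) merge)
  where
  disjoint : ∀ {x y} → x < y → y < n → NearLow a x y → NearHigh n a x y → ⊥
  disjoint {x} {y} _ _ (_ , y≤x+a) (inj₁ (_ , _ , x+n≤y+a)) = ℕ.<⇒≱ 2a<n (ℕ.+-cancelˡ-≤ x n (a + a) (begin
    x + n        ≤⟨ x+n≤y+a ⟩
    y + a        ≤⟨ ℕ.+-monoˡ-≤ a y≤x+a ⟩
    x + a + a    ≡⟨ ℕ.+-assoc x a a ⟩
    x + (a + a)  ∎))
  disjoint _ _ (x<a , _) (inj₂ (a≤x , _)) = ℕ.<⇒≱ x<a a≤x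

  split : ∀ {x y} → x < y → y < n → Near n a x y → NearLow a x y ⊎ NearHigh n a x y
  split {x} x<y y<n (inj₁ y≤x+a) with x <? a
  ... | yes x<a = inj₁ (x<a , y≤x+a)
  ... | no x≮a  = inj₂ (inj₂ (ℕ.≮⇒≥ x≮a , y≤x+a))
  split {x} {y} x<y y<n (inj₂ x+n≤y+a) = inj₂ (inj₁ (x<a , a≤y , x+n≤y+a))
    where
    x<a : x < a
    x<a = ℕ.≰⇒> (λ a≤x → ℕ.<⇒≱ (begin-strict
      y + a  <⟨ ℕ.+-mono-<-≤ y<n a≤x ⟩
      n + x  ≡⟨ ℕ.+-comm n x ⟩
      x + n  ∎) x+n≤y+a)
    a≤y : a ≤ y
    a≤y = ℕ.≮⇒≥ (λ y<a → ℕ.<⇒≱ (begin-strict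
      y + a  <⟨ ℕ.+-monoˡ-< a y<a ⟩
      a + a  <⟨ 2a<n ⟩
      n      ≤⟨ ℕ.m≤n+m n x ⟩
      x + n  ∎) x+n≤y+a)

  merge : ∀ {x y} → NearLow a x y ⊎ NearHigh n a x y → Near n a x y
  merge (inj₁ (_ , y≤x+a))                = inj₁ y≤x+a
  merge (inj₂ (inj₁ (_ , _ , x+n≤y+a)))   = inj₂ x+n≤y+a
  merge (inj₂ (inj₂ (_ , y≤x+a)))         = inj₁ y≤x+a

cycPow-TRVG : ∀ n a → IsTRVG (CycPow n a)
cycPow-TRVG n a with n ≤? a + a
... | yes n≤2a = cycPow-TRVG-≤2a n≤2a
... | no n≰2a  = cycPow-TRVG->2a (ℕ.≰⇒> n≰2a)

-- The complement of a cycle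

parity-suc : ∀ x → parity (suc x) ≢ parity x
parity-suc x eq = p≢p⁻¹ (parity (suc x)) (trans eq (sym (suc-homo-⁻¹ x)))

m<n⇒1+m<1+o+n : ∀ {m n o} → m < n → suc m < suc o + n
m<n⇒1+m<1+o+n {n = n} {o} m<n = s≤s (ℕ.≤-trans m<n (ℕ.m≤n+m n o))

same-parity⇒2+ : ∀ {x y} → parity x ≡ parity y → x < y → suc x < y
same-parity⇒2+ {x} eq x<y with ℕ.m≤n⇒m<n∨m≡n x<y
... | inj₁ 1+x<y = 1+x<y
... | inj₂ refl  = ⊥-elim (parity-suc x (sym eq))

oddReach : ℕ → ℕ → Interval
oddReach n x with parity x
... | 0ℙ = point x
... | 1ℙ = gap (suc x) (suc n)

oddReaches : ∀ {n} → Representation n (λ x y → parity x ≡ 1ℙ × suc x < y)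
oddReaches {n} = record
  { extent   = oddReach n
  ; proper   = proper
  ; overlap⇔ = λ x<y y<n → mk⇔ (reached x<y) (reaches x<y y<n)
  }
  where
  proper : ∀ {x} → x < n → Proper (oddReach n x)
  proper {x} x<n with parity x
  ... | 0ℙ = point-proper x
  ... | 1ℙ = gap-proper (s≤s x<n)

  reached : ∀ {x y} → x < y → Overlap (oddReach n x) (oddReach n y) → parity x ≡ 1ℙ × suc x < y
  reached {x} {y} x<y o with parity x in px | parity y in py
  ... | 0ℙ | 0ℙ = ⊥-elim (ℕ.<-irrefl (to (point-overlap⇔ {x} {y}) o) x<y)
  ... | 0ℙ | 1ℙ =
    ⊥-elim (ℕ.<-asym x<y (ℕ.<-trans (ℕ.n<1+n y) (proj₁ (to (point-gap-overlap⇔ {x} {suc y} {suc n}) o))))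
  ... | 1ℙ | 0ℙ = refl , proj₁ (to (gap-point-overlap⇔ {y} {suc x} {suc n}) o)
  ... | 1ℙ | 1ℙ = refl , same-parity⇒2+ (trans px (sym py)) x<y

  reaches : ∀ {x y} → x < y → y < n → parity x ≡ 1ℙ × suc x < y → Overlap (oddReach n x) (oddReach n y)
  reaches {x} {y} x<y y<n (_ , 1+x<y) with parity x | parity y
  ... | 1ℙ | 0ℙ = from gap-point-overlap⇔ (1+x<y , ℕ.m<n⇒m<1+n y<n)
  ... | 1ℙ | 1ℙ = from gap-overlap⇔ (s≤s (ℕ.<-trans x<y y<n) , s≤s y<n)

-- With n = k + 2, even vertices reach past their successor as odd ones do in oddReach, but 0 must
-- stop short of the last vertex k + 1; so an even vertex among the last two, which has no later
-- neighbour, is kept left of k + 1, within reach of 0.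
evenReach : ℕ → ℕ → Interval
evenReach k zero = gap 1 (suc k)
evenReach k (suc x) with parity (suc x) | suc x <? k
... | 0ℙ | yes _ = gap (suc (suc x)) (suc (suc (suc k)))
... | 0ℙ | no _  = gap (suc x) (suc (suc x))
... | 1ℙ | _     = point (suc x)

evenReaches : ∀ {k} → 1 ≤ k →
              Representation (suc (suc k)) (λ x y → parity x ≡ 0ℙ × suc x < y × suc y < x + suc (suc k))
evenReaches {k} 1≤k = record
  { extent   = evenReach k
  ; proper   = proper
  ; overlap⇔ = λ x<y y<n → mk⇔ (reached x<y y<n) (reaches x<y y<n)
  }
  where
  n : ℕ
  n = suc (suc k)

  proper : ∀ {x} → x < n → Proper (evenReach k x)
  proper {zero} _ = gap-proper (s≤s 1≤k)
  proper {suc x} 1+x<n with parity (suc x) | suc x <? k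
  ... | 0ℙ | yes 1+x<k = gap-proper (s≤s (s≤s (ℕ.m<n⇒m≤1+n 1+x<k)))
  ... | 0ℙ | no _      = gap-proper (ℕ.n<1+n (suc x))
  ... | 1ℙ | _         = point-proper (suc x)

  reached : ∀ {x y} → x < y → y < n → Overlap (evenReach k x) (evenReach k y) →
            parity x ≡ 0ℙ × suc x < y × suc y < x + n
  reached {zero} {suc y} _ _ o with parity (suc y) in py | suc y <? k
  ... | 0ℙ | yes 1+y<k = refl , same-parity⇒2+ (sym py) (s≤s z≤n) , s≤s (s≤s (ℕ.<⇒≤ 1+y<k))
  ... | 0ℙ | no _      = refl , same-parity⇒2+ (sym py) (s≤s z≤n) ,
                         s≤s (proj₂ (to (gap-overlap⇔ {1} {suc k} {suc y} {suc (suc y)}) o))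
  ... | 1ℙ | _         = refl , proj₁ (to (gap-point-overlap⇔ {suc y} {1} {suc k}) o) ,
                         s≤s (proj₂ (to (gap-point-overlap⇔ {suc y} {1} {suc k}) o))
  reached {suc x} {suc y} (s≤s x<y) y<n o with parity (suc x) in px | suc x <? k | parity (suc y) in py | suc y <? k
  ... | 0ℙ | yes _   | 0ℙ | _       = refl , same-parity⇒2+ (trans px (sym py)) (s≤s x<y) , m<n⇒1+m<1+o+n y<n
  ... | 0ℙ | yes _   | 1ℙ | _       =
    refl , proj₁ (to (gap-point-overlap⇔ {suc y} {suc (suc x)} {suc n}) o) , m<n⇒1+m<1+o+n y<n
  ... | 0ℙ | no 1+x≮k | 0ℙ | yes 1+y<k = ⊥-elim (1+x≮k (ℕ.<-trans (s≤s x<y) 1+y<k))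
  ... | 0ℙ | no 1+x≮k | 0ℙ | no _   = ⊥-elim (ℕ.<⇒≱ y<n (ℕ.≤-trans (s≤s (s≤s (ℕ.≮⇒≥ 1+x≮k)))
                                        (same-parity⇒2+ (trans px (sym py)) (s≤s x<y))))
  ... | 0ℙ | no _   | 1ℙ | _       = ⊥-elim (ℕ.<⇒≱ (s≤s x<y)
                                        (s≤s⁻¹ (proj₂ (to (gap-point-overlap⇔ {suc y} {suc x} {suc (suc x)}) o))))
  ... | 1ℙ | _       | 0ℙ | yes _   = ⊥-elim (ℕ.<-asym (s≤s x<y) (ℕ.<-trans (ℕ.n<1+n (suc y))
                                        (proj₁ (to (point-gap-overlap⇔ {suc x} {suc (suc y)} {suc n}) o))))
  ... | 1ℙ | _       | 0ℙ | no _    =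
    ⊥-elim (ℕ.<-asym (s≤s x<y) (proj₁ (to (point-gap-overlap⇔ {suc x} {suc y} {suc (suc y)}) o)))
  ... | 1ℙ | _       | 1ℙ | _       = ⊥-elim (ℕ.<-irrefl (to (point-overlap⇔ {suc x} {suc y}) o) (s≤s x<y))

  reaches : ∀ {x y} → x < y → y < n → parity x ≡ 0ℙ × suc x < y × suc y < x + n →
            Overlap (evenReach k x) (evenReach k y)
  reaches {zero} {suc y} _ _ (_ , 1<1+y , 2+y<n) with parity (suc y) | suc y <? k
  ... | 0ℙ | yes 1+y<k = from (gap-overlap⇔ {1} {suc k} {suc (suc y)} {suc n}) (s≤s (s≤s z≤n) , s≤s 1+y<k)
  ... | 0ℙ | no _      = from (gap-overlap⇔ {1} {suc k} {suc y} {suc (suc y)}) (s≤s (s≤s z≤n) , s≤s⁻¹ 2+y<n)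
  ... | 1ℙ | _         = from gap-point-overlap⇔ (1<1+y , s≤s⁻¹ 2+y<n)
  reaches {suc x} {suc y} _ y<n (_ , 2+x<1+y , _) with parity (suc x) | suc x <? k | parity (suc y) | suc y <? k
  ... | 0ℙ | no 1+x≮k | _  | _     = ⊥-elim (ℕ.<⇒≱ y<n (ℕ.≤-trans (s≤s (s≤s (ℕ.≮⇒≥ 1+x≮k))) 2+x<1+y))
  ... | 0ℙ | yes _    | 0ℙ | yes _ =
    from gap-overlap⇔ (s≤s (ℕ.<-trans (ℕ.<-trans (ℕ.n<1+n _) 2+x<1+y) y<n) , s≤s y<n)
  ... | 0ℙ | yes _    | 0ℙ | no _  = from gap-overlap⇔ (ℕ.m<n⇒m<1+n 2+x<1+y , ℕ.<-trans y<n (ℕ.n<1+n n))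
  ... | 0ℙ | yes _    | 1ℙ | _     = from gap-point-overlap⇔ (2+x<1+y , ℕ.<-trans y<n (ℕ.n<1+n n))

cycPowCompl-1-TRVG : ∀ {n} → 3 ≤ n → IsTRVG (CycPowCompl n 1)
cycPowCompl-1-TRVG {suc (suc k)} (s≤s (s≤s 1≤k)) =
  cycPowCompl-representations⇒TRVG (evenReaches 1≤k) oddReaches
    (λ _ _ (even , _) (odd , _) → 0ℙ≢1ℙ (trans (sym even) odd)) (λ x<y y<n → mk⇔ (split y<n) (merge y<n))
  where
  n : ℕ
  n = suc (suc k)

  0ℙ≢1ℙ : 0ℙ ≢ 1ℙ
  0ℙ≢1ℙ ()

  +1≡suc : ∀ x → x + 1 ≡ suc x
  +1≡suc x = ℕ.+-comm x 1

  split : ∀ {x y} → y < n → Far n 1 x y →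
          (parity x ≡ 0ℙ × suc x < y × suc y < x + n) ⊎ (parity x ≡ 1ℙ × suc x < y)
  split {x} {y} _ (x+1<y , y+1<x+n) with parity x
  ... | 0ℙ = inj₁ (refl , subst (_< y) (+1≡suc x) x+1<y , subst (_< x + n) (+1≡suc y) y+1<x+n)
  ... | 1ℙ = inj₂ (refl , subst (_< y) (+1≡suc x) x+1<y)

  merge : ∀ {x y} → y < n → (parity x ≡ 0ℙ × suc x < y × suc y < x + n) ⊎ (parity x ≡ 1ℙ × suc x < y) →
          Far n 1 x y
  merge {x} {y} _ (inj₁ (_ , 1+x<y , 1+y<x+n)) =
    subst (_< y) (sym (+1≡suc x)) 1+x<y , subst (_< x + n) (sym (+1≡suc y)) 1+y<x+n
  merge {zero} _ (inj₂ (() , _))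
  merge {suc x} {y} y<n (inj₂ (_ , 2+x<y)) =
    subst (_< y) (sym (+1≡suc (suc x))) 2+x<y , subst (_< suc x + n) (sym (+1≡suc y)) (m<n⇒1+m<1+o+n y<n)

-- Induced bicliques

meet-sym : ∀ {a b c d} → Meet a b c d → Meet c d a b
meet-sym (z , in-ab , in-cd) = z , in-cd , in-ab

-- the larger of the two common points lies in all three intervals
meet-fan : ∀ {a b c d e f} → Meet a b c d → Meet a b e f → b ℚ.≤ d → b ℚ.≤ f → Meet c d e f
meet-fan (z₁ , (_ , z₁<b) , c<z₁ , z₁<d) (z₂ , (_ , z₂<b) , e<z₂ , z₂<f) b≤d b≤f with z₁ ℚ.≤? z₂
... | yes z₁≤z₂ = z₂ , (ℚ.<-≤-trans c<z₁ z₁≤z₂ , ℚ.<-≤-trans z₂<b b≤d) , e<z₂ , z₂<f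
... | no z₁≰z₂  = z₁ , (c<z₁ , z₁<d) , ℚ.<-trans e<z₂ (ℚ.≰⇒> z₁≰z₂) , ℚ.<-≤-trans z₁<b b≤f

begins ends : Fin 2 → Rect → ℚ
begins zero   = x₁
begins (suc _) = y₁
ends zero     = x₂
ends (suc _)  = y₂

MeetsAlong : Fin 2 → Rect → Rect → Set
MeetsAlong g r s = Meet (begins g r) (ends g r) (begins g s) (ends g s)

visible⇒meetsAlong : ∀ {r s} → Visible r s → ∃[ g ] MeetsAlong g r s
visible⇒meetsAlong (inj₁ horizontal) = suc zero , horizontal
visible⇒meetsAlong (inj₂ vertical)   = zero , vertical

meetsAlong⇒visible : ∀ {g r s} → MeetsAlong g r s → Visible r s
meetsAlong⇒visible {zero}     vertical   = inj₂ vertical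
meetsAlong⇒visible {suc zero} horizontal = inj₁ horizontal

maximum : ∀ {m} (f : Fin (suc m) → ℚ) → ∃[ k ] ∀ i → f i ℚ.≤ f k
maximum f = argmax f zero (allFin _) , λ i → All.lookup (f[xs]≤f[argmax] {f = f} zero (allFin _)) (∈-allFin i)

injective-missing⇒< : ∀ {m n} {f : Fin m → Fin n} → (∀ {x y} → f x ≡ f y → x ≡ y) →
                      (z : Fin n) → (∀ x → z ≢ f x) → m < n
injective-missing⇒< {n = suc k} f-injective z z∉f =
  s≤s (Fin.injective⇒≤ {f = λ x → punchOut (z∉f x)} (f-injective ∘ Fin.punchOut-injective (z∉f _) (z∉f _)))

-- an axis together with one of P + Q rectangles
Slot : ℕ → ℕ → Set
Slot P Q = Fin 2 × (Fin P ⊎ Fin Q)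

module _ {P Q : ℕ} where

  private
    slotIndex : Slot P Q → Fin (2 * (P + Q))
    slotIndex (g , t) = combine g (join P Q t)

    slotIndex-injective : ∀ {σ σ′} → slotIndex σ ≡ slotIndex σ′ → σ ≡ σ′
    slotIndex-injective {g , t} {g′ , t′} eq with Fin.combine-injective g (join P Q t) g′ (join P Q t′) eq
    ... | refl , joins≡ =
      cong (g ,_) (trans (sym (Fin.splitAt-join P Q t)) (trans (cong (splitAt P) joins≡) (Fin.splitAt-join P Q t′)))

    remQuot-injective : ∀ {e e′ : Fin (P * Q)} → remQuot {P} Q e ≡ remQuot Q e′ → e ≡ e′
    remQuot-injective {e} {e′} eq =
      trans (sym (Fin.combine-remQuot {P} Q e)) (trans (cong (uncurry combine) eq) (Fin.combine-remQuot {P} Q e′))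

  slots-missing⇒< : (slot : Fin P × Fin Q → Slot P Q) → (∀ {x y} → slot x ≡ slot y → x ≡ y) →
                    (σ₀ : Slot P Q) → (∀ x → σ₀ ≢ slot x) → P * Q < 2 * (P + Q)
  slots-missing⇒< slot slot-injective σ₀ σ₀∉slot =
    injective-missing⇒< {f = slotIndex ∘ slot ∘ remQuot {P} Q}
      (remQuot-injective ∘ slot-injective ∘ slotIndex-injective)
      (slotIndex σ₀) (λ e → σ₀∉slot (remQuot {P} Q e) ∘ slotIndex-injective)

module _ {p q} (r : Fin (suc p) → Rect) (s : Fin (suc q) → Rect)
         (r-independent : ∀ {i i′} → i ≢ i′ → ¬ Visible (r i) (r i′))
         (s-independent : ∀ {j j′} → j ≢ j′ → ¬ Visible (s j) (s j′))
         (r-s-visible : ∀ i j → Visible (r i) (s j)) where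

  data Charge (i : Fin (suc p)) (j : Fin (suc q)) : Slot (suc p) (suc q) → Set where
    left  : ∀ {g} → MeetsAlong g (r i) (s j) → ends g (r i) ℚ.≤ ends g (s j) → Charge i j (g , inj₁ i)
    right : ∀ {g} → MeetsAlong g (r i) (s j) → ends g (s j) ℚ.< ends g (r i) → Charge i j (g , inj₂ j)

  charge : ∀ i j → ∃ (Charge i j)
  charge i j with visible⇒meetsAlong (r-s-visible i j)
  ... | g , meets with ends g (r i) ℚ.≤? ends g (s j)
  ...   | yes r≤s = _ , left {g = g} meets r≤s
  ...   | no r≰s  = _ , right {g = g} meets (ℚ.≰⇒> r≰s)

  charge-injective : ∀ {i i′ j j′ σ} → Charge i j σ → Charge i′ j′ σ → i ≡ i′ × j ≡ j′
  charge-injective {j = j} {j′ = j′} (left {g = g} meets r≤s) (left meets′ r≤s′) with j Fin.≟ j′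
  ... | yes j≡j′ = refl , j≡j′
  ... | no j≢j′  = ⊥-elim (s-independent j≢j′ (meetsAlong⇒visible {g} (meet-fan meets meets′ r≤s r≤s′)))
  charge-injective {i = i} {i′ = i′} (right {g = g} meets s<r) (right meets′ s<r′) with i Fin.≟ i′
  ... | yes i≡i′ = i≡i′ , refl
  ... | no i≢i′  = ⊥-elim (r-independent i≢i′
                     (meetsAlong⇒visible {g}
                       (meet-fan (meet-sym meets) (meet-sym meets′) (ℚ.<⇒≤ s<r) (ℚ.<⇒≤ s<r′))))

  -- the rectangle whose x-extent ends last, with ties going to the s side, is never charged along the x-axis
  uncharged : ∃[ σ ] ∀ {i j} → ¬ Charge i j σ
  uncharged = last-ending (maximum (ends zero ∘ r)) (maximum (ends zero ∘ s))
    where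
    last-ending : (∃[ i₀ ] ∀ i → ends zero (r i) ℚ.≤ ends zero (r i₀)) →
                  (∃[ j₀ ] ∀ j → ends zero (s j) ℚ.≤ ends zero (s j₀)) →
                  ∃[ σ ] ∀ {i j} → ¬ Charge i j σ
    last-ending (i₀ , r≤r₀) (j₀ , s≤s₀) with ends zero (r i₀) ℚ.≤? ends zero (s j₀)
    ... | yes r₀≤s₀ =
      (zero , inj₂ j₀) , λ { (right _ s₀<r) → ℚ.<-irrefl refl (ℚ.<-≤-trans s₀<r (ℚ.≤-trans (r≤r₀ _) r₀≤s₀)) }
    ... | no r₀≰s₀  = (zero , inj₁ i₀) , λ { (left _ r₀≤s) → r₀≰s₀ (ℚ.≤-trans r₀≤s (s≤s₀ _)) }

  chargedSlot : Fin (suc p) × Fin (suc q) → Slot (suc p) (suc q)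
  chargedSlot (i , j) = proj₁ (charge i j)

  chargedSlot-injective : ∀ {ij i′j′} → chargedSlot ij ≡ chargedSlot i′j′ → ij ≡ i′j′
  chargedSlot-injective {i , j} {i′ , j′} slots≡ = uncurry (cong₂ _,_)
    (charge-injective (proj₂ (charge i j)) (subst (Charge i′ j′) (sym slots≡) (proj₂ (charge i′ j′))))

  uncharged-unused : ∀ ij → proj₁ uncharged ≢ chargedSlot ij
  uncharged-unused (i , j) σ₀≡ = proj₂ uncharged (subst (Charge i j) (sym σ₀≡) (proj₂ (charge i j)))

  biclique-bound : suc p * suc q < 2 * (suc p + suc q)
  biclique-bound = slots-missing⇒< chargedSlot chargedSlot-injective (proj₁ uncharged) uncharged-unused

trvg-biclique-bound : ∀ {n p q} {G : Graph n} → IsTRVG G →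
                      (f : Fin (suc p) → Fin n) (g : Fin (suc q) → Fin n) →
                      (∀ {i i′} → i ≢ i′ → f i ≢ f i′ × ¬ G (f i) (f i′)) →
                      (∀ {j j′} → j ≢ j′ → g j ≢ g j′ × ¬ G (g j) (g j′)) →
                      (∀ i j → f i ≢ g j × G (f i) (g j)) →
                      suc p * suc q < 2 * (suc p + suc q)
trvg-biclique-bound {n} {G = G} (R , _ , _ , sees) f g f-independent g-independent f-g-adjacent =
  biclique-bound (R ∘ f) (R ∘ g) (invisible f-independent) (invisible g-independent) visible
  where
  invisible : ∀ {m} {h : Fin m → Fin n} → (∀ {i i′} → i ≢ i′ → h i ≢ h i′ × ¬ G (h i) (h i′)) →
              ∀ {i i′} → i ≢ i′ → ¬ Visible (R (h i)) (R (h i′))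
  invisible h-independent i≢i′ = proj₂ (h-independent i≢i′) ∘ proj₂ (sees _ _ (proj₁ (h-independent i≢i′)))

  visible : ∀ i j → Visible (R (f i)) (R (g j))
  visible i j = proj₁ (sees _ _ (proj₁ (f-g-adjacent i j))) (proj₂ (f-g-adjacent i j))

module _ {n a : ℕ} (3≤a : 3 ≤ a) (2a+8≤n : 2 * a + 8 ≤ n) where

  private
    last<n : 4 + a + 3 + a < n
    last<n = ℕ.≤-trans (ℕ.≤-reflexive (shuffle a)) 2a+8≤n
      where
      shuffle : ∀ a → suc (4 + a + 3 + a) ≡ 2 * a + 8
      shuffle = solve-∀

    ≤3 : ∀ (i : Fin 4) → toℕ i ≤ 3
    ≤3 i = s≤s⁻¹ (Fin.toℕ<n i)

    block : ∀ b → b ≤ 4 + a → Fin 4 → Fin n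
    block b b≤4+a i = fromℕ< (begin-strict
      b + toℕ i      ≤⟨ ℕ.+-mono-≤ b≤4+a (≤3 i) ⟩
      4 + a + 3      ≤⟨ ℕ.m≤m+n (4 + a + 3) a ⟩
      4 + a + 3 + a  <⟨ last<n ⟩
      n              ∎)

    toℕ-block : ∀ {b} b≤4+a i → toℕ (block b b≤4+a i) ≡ b + toℕ i
    toℕ-block _ i = Fin.toℕ-fromℕ< _

    block-independent : ∀ {b} (b≤4+a : b ≤ 4 + a) {i i′} → i ≢ i′ →
                        block b b≤4+a i ≢ block b b≤4+a i′ ×
                        ¬ CycPowCompl n a (block b b≤4+a i) (block b b≤4+a i′)
    block-independent {b} b≤4+a {i} {i′} i≢i′ =
      distinct , λ (_ , ¬adjacent) → ¬adjacent (cycPow-within distinct (close i′ i) (close i i′))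
      where
      distinct : block b b≤4+a i ≢ block b b≤4+a i′
      distinct eq = i≢i′ (Fin.toℕ-injective (ℕ.+-cancelˡ-≡ b _ _
        (trans (sym (toℕ-block b≤4+a i)) (trans (cong toℕ eq) (toℕ-block b≤4+a i′)))))

      close : ∀ k l → toℕ (block b b≤4+a k) ≤ toℕ (block b b≤4+a l) + a
      close k l = begin
        toℕ (block b b≤4+a k)      ≡⟨ toℕ-block b≤4+a k ⟩
        b + toℕ k                  ≤⟨ ℕ.+-monoʳ-≤ b (ℕ.≤-trans (≤3 k) 3≤a) ⟩
        b + a                      ≤⟨ ℕ.+-monoˡ-≤ a (ℕ.m≤m+n b (toℕ l)) ⟩
        b + toℕ l + a              ≡⟨ cong (_+ a) (sym (toℕ-block b≤4+a l)) ⟩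
        toℕ (block b b≤4+a l) + a  ∎

    low high : Fin 4 → Fin n
    low  = block 0 z≤n
    high = block (4 + a) ℕ.≤-refl

    low-high-adjacent : ∀ i j → low i ≢ high j × CycPowCompl n a (low i) (high j)
    low-high-adjacent i j = (λ eq → ℕ.<-irrefl (cong toℕ eq) low<high) , from (cycPowCompl⇔far low<high) far
      where
      low<high : toℕ (low i) < toℕ (high j)
      low<high = begin-strict
        toℕ (low i)     ≡⟨ toℕ-block z≤n i ⟩
        toℕ i           ≤⟨ ≤3 i ⟩
        3               <⟨ s≤s (s≤s (s≤s (s≤s z≤n))) ⟩
        4 + a + toℕ j   ≡⟨ sym (toℕ-block ℕ.≤-refl j) ⟩
        toℕ (high j)    ∎

      far : Far n a (toℕ (low i)) (toℕ (high j))
      far = subst₂ (Far n a) (sym (toℕ-block z≤n i)) (sym (toℕ-block ℕ.≤-refl j)) ((begin-strict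
        toℕ i + a          ≤⟨ ℕ.+-monoˡ-≤ a (≤3 i) ⟩
        3 + a              <⟨ ℕ.≤-refl ⟩
        4 + a              ≤⟨ ℕ.m≤m+n (4 + a) (toℕ j) ⟩
        4 + a + toℕ j      ∎) , (begin-strict
        4 + a + toℕ j + a  ≤⟨ ℕ.+-monoˡ-≤ a (ℕ.+-monoʳ-≤ (4 + a) (≤3 j)) ⟩
        4 + a + 3 + a      <⟨ last<n ⟩
        n                  ≤⟨ ℕ.m≤n+m n (toℕ i) ⟩
        toℕ i + n          ∎))

  cycPowCompl-not-TRVG : ¬ IsTRVG (CycPowCompl n a)
  cycPowCompl-not-TRVG trvg = ℕ.<-irrefl refl
    (trvg-biclique-bound trvg low high (block-independent z≤n) (block-independent ℕ.≤-refl) low-high-adjacent)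

-- Complements of powers of short cycles

partner : ℕ → ℕ → ℕ
partner s x with x <? s
... | yes _ = x + s
... | no _  = x

matching : ∀ {n s} → n ≤ s + s → Representation n (λ x y → y ≡ x + s)
matching {n} {s} n≤2s = record
  { extent   = point ∘ partner s
  ; proper   = λ {x} _ → point-proper (partner s x)
  ; overlap⇔ = λ x<y y<n → ⇔.trans point-overlap⇔ (mk⇔ (partners⇒ x<y) (⇒partners x<y y<n))
  }
  where
  partners⇒ : ∀ {x y} → x < y → partner s x ≡ partner s y → y ≡ x + s
  partners⇒ {x} {y} x<y eq with x <? s | y <? s
  ... | yes _   | yes _   = ⊥-elim (ℕ.<-irrefl (ℕ.+-cancelʳ-≡ s x y eq) x<y)
  ... | yes _   | no _    = sym eq
  ... | no x≮s  | yes y<s = ⊥-elim (x≮s (ℕ.<-trans x<y y<s))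
  ... | no _    | no _    = ⊥-elim (ℕ.<-irrefl eq x<y)
  ⇒partners : ∀ {x y} → x < y → y < n → y ≡ x + s → partner s x ≡ partner s y
  ⇒partners {x} {y} x<y y<n refl with x <? s | (x + s) <? s
  ... | _       | yes x+s<s = ⊥-elim (ℕ.<⇒≱ x+s<s (ℕ.m≤n+m s x))
  ... | yes _   | no _      = refl
  ... | no x≮s  | no _      = ⊥-elim (ℕ.<⇒≱ y<n (ℕ.≤-trans n≤2s (ℕ.+-monoˡ-≤ s (ℕ.≮⇒≥ x≮s))))

data Third (h x : ℕ) : Set where
  first  : x < h → Third h x
  second : h ≤ x → x < h + h → Third h x
  third  : h + h ≤ x → Third h x

third? : ∀ h x → Third h x
third? h x with x <? h | x <? h + h
... | yes x<h | _        = first x<h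
... | no x≮h  | yes x<2h = second (ℕ.≮⇒≥ x≮h) x<2h
... | no _    | no x≮2h  = third (ℕ.≮⇒≥ x≮2h)

-- x, x + h and x + 2h share a unit, their position, where the interval of the middle one meets the other two
position : ∀ {h x} → Third h x → ℕ
position {h} {x} (first _)    = x + h + h
position {h} {x} (second _ _) = x + h
position {h} {x} (third _)    = x

entry exit : ∀ {h x} → Third h x → ℕ
entry (first _)    = 0
entry (second _ _) = 0
entry (third _)    = 2
exit (first _)     = 1
exit (second _ _)  = 3
exit (third _)     = 3

exit≤3 : ∀ {h x} (t : Third h x) → exit t ≤ 3
exit≤3 (first _)    = s≤s z≤n
exit≤3 (second _ _) = ℕ.≤-refl
exit≤3 (third _)    = ℕ.≤-refl

entry<exit : ∀ {h x} (t : Third h x) → entry t < exit t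
entry<exit (first _)    = s≤s z≤n
entry<exit (second _ _) = s≤s z≤n
entry<exit (third _)    = s≤s (s≤s (s≤s z≤n))

link : ∀ {h x} → Third h x → Interval
link t = unit (position t) (entry t) (exit t)

link-proper : ∀ {h x} (t : Third h x) → Proper (link t)
link-proper t = unit-proper {position t} (entry<exit t)

link-overlap⇔ : ∀ {h x y} (s : Third h x) (t : Third h y) →
                Overlap (link s) (link t) ⇔ (position s ≡ position t × entry s < exit t × entry t < exit s)
link-overlap⇔ s t = unit-overlap⇔ {position s} {position t} (exit≤3 s) (exit≤3 t)

chains : ∀ {n h} → n ≤ h + h + h → Representation n (λ x y → y ≡ x + h)
chains {n} {h} n≤3h = record
  { extent   = λ x → link (third? h x)
  ; proper   = λ {x} _ → link-proper (third? h x)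
  ; overlap⇔ = λ {x} {y} x<y y<n →
                 mk⇔ (linked⇒ x<y (third? h x) (third? h y)) (⇒linked x<y y<n (third? h x) (third? h y))
  }
  where
  linked⇒ : ∀ {x y} → x < y → (s : Third h x) (t : Third h y) → Overlap (link s) (link t) → y ≡ x + h
  linked⇒ x<y s t o with s | t | to (link-overlap⇔ s t) o
  ... | first _        | first _         | eq , _ =
    ⊥-elim (ℕ.<-irrefl (ℕ.+-cancelʳ-≡ h _ _ (ℕ.+-cancelʳ-≡ h _ _ eq)) x<y)
  ... | first _        | second _ _      | eq , _ = sym (ℕ.+-cancelʳ-≡ h _ _ eq)
  ... | first _        | third _         | _ , _ , s≤s ()
  ... | second h≤x _   | first y<h       | _ = ⊥-elim (ℕ.<⇒≱ (ℕ.<-trans x<y y<h) h≤x)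
  ... | second _ _     | second _ _      | eq , _ = ⊥-elim (ℕ.<-irrefl (ℕ.+-cancelʳ-≡ h _ _ eq) x<y)
  ... | second _ _     | third _         | eq , _ = sym eq
  ... | third 2h≤x     | first y<h       | _ =
    ⊥-elim (ℕ.<⇒≱ (ℕ.<-trans x<y (ℕ.<-≤-trans y<h (ℕ.m≤m+n h h))) 2h≤x)
  ... | third 2h≤x     | second _ y<2h   | _ = ⊥-elim (ℕ.<⇒≱ (ℕ.<-trans x<y y<2h) 2h≤x)
  ... | third _        | third _         | eq , _ = ⊥-elim (ℕ.<-irrefl eq x<y)

  ⇒linked : ∀ {x y} → x < y → y < n → (s : Third h x) (t : Third h y) → y ≡ x + h →
            Overlap (link s) (link t)
  ⇒linked {x} _ _ (first _) (first x+h<h) refl = ⊥-elim (ℕ.<⇒≱ x+h<h (ℕ.m≤n+m h x))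
  ⇒linked _ _ s@(first _) t@(second _ _) refl = from (link-overlap⇔ s t) (refl , s≤s z≤n , s≤s z≤n)
  ⇒linked {x} _ _ (first x<h) (third 2h≤x+h) refl = ⊥-elim (ℕ.<⇒≱ (ℕ.+-monoˡ-< h x<h) 2h≤x+h)
  ⇒linked {x} _ _ (second _ _) (first x+h<h) refl = ⊥-elim (ℕ.<⇒≱ x+h<h (ℕ.m≤n+m h x))
  ⇒linked _ _ (second h≤x _) (second _ x+h<2h) refl = ⊥-elim (ℕ.<⇒≱ x+h<2h (ℕ.+-monoˡ-≤ h h≤x))
  ⇒linked _ _ s@(second _ _) t@(third _) refl =
    from (link-overlap⇔ s t) (refl , s≤s z≤n , s≤s (s≤s (s≤s z≤n)))
  ⇒linked _ y<n (third 2h≤x) _ refl = ⊥-elim (ℕ.<⇒≱ y<n (ℕ.≤-trans n≤3h (ℕ.+-monoˡ-≤ h 2h≤x)))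

-- x < m straddles the units of x + m and x + m + 1, whose own intervals are the first halves of those units
zig : ℕ → ℕ → Interval
zig m x with x <? m
... | yes _ = [ x + m ∙ 1 , suc (x + m) ∙ 1 ]
... | no _  = unit x 0 2

zig-proper : ∀ m x → Proper (zig m x)
zig-proper m x with x <? m
... | yes _ = <⇒∙<∙ 1 1 (s≤s z≤n) (ℕ.n<1+n (x + m))
... | no _  = unit-proper {x} (s≤s z≤n)

zigzag : ∀ {n m} → n ≤ m + m → Representation n (λ x y → y ≡ x + m ⊎ y ≡ x + suc m)
zigzag {n} {m} n≤2m = record
  { extent   = zig m
  ; proper   = λ {x} _ → zig-proper m x
  ; overlap⇔ = λ x<y y<n → mk⇔ (zigged⇒ x<y) (⇒zigged x<y y<n ∘ between)
  }
  where
  zigged⇒ : ∀ {x y} → x < y → Overlap (zig m x) (zig m y) → y ≡ x + m ⊎ y ≡ x + suc m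
  zigged⇒ {x} {y} x<y o with x <? m | y <? m
  ... | yes _ | yes _ =
    ⊥-elim (ℕ.<⇒≱ x<y (ℕ.+-cancelʳ-≤ m y x (s≤s⁻¹ (∙<∙⇒< 1 1 ℕ.≤-refl (proj₂ o)))))
  ... | yes _ | no _ with ℕ.m≤n⇒m<n∨m≡n (∙<∙⇒≤ 0 1 (s≤s z≤n) (proj₂ o))
  ...   | inj₁ y≤x+m = inj₁ (ℕ.≤-antisym (s≤s⁻¹ y≤x+m) (∙<∙⇒≤ 1 2 (s≤s (s≤s z≤n)) (proj₁ o)))
  ...   | inj₂ y≡1+x+m = inj₂ (trans y≡1+x+m (sym (ℕ.+-suc x m)))
  zigged⇒ x<y o | no x≮m | yes y<m = ⊥-elim (x≮m (ℕ.<-trans x<y y<m))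
  zigged⇒ {x} {y} x<y o | no _ | no _ =
    ⊥-elim (ℕ.<-irrefl (proj₁ (to (unit-overlap⇔ {x} {y} (s≤s (s≤s z≤n)) (s≤s (s≤s z≤n))) o)) x<y)

  between : ∀ {x y} → y ≡ x + m ⊎ y ≡ x + suc m → x + m ≤ y × y ≤ suc (x + m)
  between (inj₁ refl) = ℕ.≤-refl , ℕ.n≤1+n _
  between {x} (inj₂ refl) =
    ℕ.≤-trans (ℕ.n≤1+n _) (ℕ.≤-reflexive (sym (ℕ.+-suc x m))) , ℕ.≤-reflexive (ℕ.+-suc x m)

  ⇒zigged : ∀ {x y} → x < y → y < n → x + m ≤ y × y ≤ suc (x + m) → Overlap (zig m x) (zig m y)
  ⇒zigged {x} {y} x<y y<n (x+m≤y , y≤1+x+m) with x <? m | y <? m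
  ... | no x≮m | _ = ⊥-elim (ℕ.<⇒≱ y<n (begin
    n      ≤⟨ n≤2m ⟩
    m + m  ≤⟨ ℕ.+-monoˡ-≤ m (ℕ.≮⇒≥ x≮m) ⟩
    x + m  ≤⟨ x+m≤y ⟩
    y      ∎))
  ... | yes _ | yes y<m = ⊥-elim (ℕ.<⇒≱ y<m (ℕ.≤-trans (ℕ.m≤n+m m x) x+m≤y))
  ... | yes _ | no _ = ≤⇒∙<∙ 1 2 (s≤s (s≤s z≤n)) x+m≤y , ≤⇒∙<∙ 0 1 (s≤s z≤n) y≤1+x+m

far-mono : ∀ {n n′ a x y} → n ≤ n′ → Far n a x y → Far n′ a x y
far-mono {x = x} n≤n′ (x+a<y , y+a<x+n) = x+a<y , ℕ.<-≤-trans y+a<x+n (ℕ.+-monoʳ-≤ x n≤n′)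

far⇔window : ∀ {a t x y} → Far (suc (a + a) + t) a x y ⇔ (∃[ j ] (j < t × y ≡ x + (j + suc a)))
far⇔window {a} {t} {x} {y} = mk⇔ far⇒window window⇒far
  where
  +-suc-shuffle : ∀ x a j → suc (x + a) + j ≡ x + (j + suc a)
  +-suc-shuffle = solve-∀

  +-window-shuffle : ∀ x a j → x + (j + suc a) + a ≡ x + suc (a + a) + j
  +-window-shuffle = solve-∀

  far⇒window : Far (suc (a + a) + t) a x y → ∃[ j ] (j < t × y ≡ x + (j + suc a))
  far⇒window (x+a<y , y+a<x+n) = j , j<t , y≡
    where
    j = y ∸ suc (x + a)
    y≡ : y ≡ x + (j + suc a)
    y≡ = trans (sym (ℕ.m+[n∸m]≡n x+a<y)) (+-suc-shuffle x a j)
    j<t : j < t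
    j<t = ℕ.+-cancelˡ-< (x + suc (a + a)) j t (begin-strict
      x + suc (a + a) + j    ≡⟨ sym (+-window-shuffle x a j) ⟩
      x + (j + suc a) + a    ≡⟨ cong (_+ a) (sym y≡) ⟩
      y + a                  <⟨ y+a<x+n ⟩
      x + (suc (a + a) + t)  ≡⟨ sym (ℕ.+-assoc x (suc (a + a)) t) ⟩
      x + suc (a + a) + t    ∎)

  window⇒far : ∃[ j ] (j < t × y ≡ x + (j + suc a)) → Far (suc (a + a) + t) a x y
  window⇒far (j , j<t , refl) = ℕ.+-monoʳ-< x (ℕ.m≤n+m (suc a) j) , (begin-strict
    x + (j + suc a) + a    ≡⟨ +-window-shuffle x a j ⟩
    x + suc (a + a) + j    <⟨ ℕ.+-monoʳ-< (x + suc (a + a)) j<t ⟩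
    x + suc (a + a) + t    ≡⟨ ℕ.+-assoc x (suc (a + a)) t ⟩
    x + (suc (a + a) + t)  ∎)

private
  pairing-bound : ∀ {a t} → t ≤ 3 → suc (a + a) + t ≤ suc (suc a) + suc (suc a)
  pairing-bound {a} t≤3 = ℕ.≤-trans (ℕ.+-monoʳ-≤ (suc (a + a)) t≤3) (ℕ.≤-reflexive (shuffle a))
    where
    shuffle : ∀ a → suc (a + a) + 3 ≡ suc (suc a) + suc (suc a)
    shuffle = solve-∀

  chaining-bound : ∀ {a t} → t ≤ suc (suc a) → suc (a + a) + t ≤ suc a + suc a + suc a
  chaining-bound {a} t≤a+2 = ℕ.≤-trans (ℕ.+-monoʳ-≤ (suc (a + a)) t≤a+2) (ℕ.≤-reflexive (shuffle a))
    where
    shuffle : ∀ a → suc (a + a) + suc (suc a) ≡ suc a + suc a + suc a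
    shuffle = solve-∀

  distinct-distances : ∀ {x y d d′} → d < d′ → y ≡ x + d → y ≡ x + d′ → ⊥
  distinct-distances {x} d<d′ y≡x+d y≡x+d′ = ℕ.<⇒≢ d<d′ (ℕ.+-cancelˡ-≡ x _ _ (trans (sym y≡x+d) y≡x+d′))

cycPowCompl-TRVG-≤2a+1 : ∀ {n a} → n ≤ suc (a + a) → IsTRVG (CycPowCompl n a)
cycPowCompl-TRVG-≤2a+1 {n} {a} n≤2a+1 =
  cycPowCompl-representations⇒TRVG points points (λ _ _ ())
    (λ _ _ → mk⇔ (⊥-elim ∘ no-window ∘ to far⇔window ∘ far-mono n≤2a+1+0) λ { (inj₁ ()) ; (inj₂ ()) })
  where
  n≤2a+1+0 : n ≤ suc (a + a) + 0
  n≤2a+1+0 = ℕ.≤-trans n≤2a+1 (ℕ.≤-reflexive (sym (ℕ.+-identityʳ _)))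
  no-window : ∀ {P : ℕ → Set} → (∃[ j ] (j < 0 × P j)) → ⊥
  no-window (_ , () , _)

cycPowCompl-TRVG-2a+2 : ∀ {a} → IsTRVG (CycPowCompl (suc (a + a) + 1) a)
cycPowCompl-TRVG-2a+2 {a} =
  cycPowCompl-representations⇒TRVG points (matching (ℕ.≤-reflexive (shuffle a))) (λ _ _ ())
    (λ _ _ → ⇔.trans far⇔window (mk⇔ window⇒ ⇒window))
  where
  shuffle : ∀ a → suc (a + a) + 1 ≡ suc a + suc a
  shuffle = solve-∀
  window⇒ : ∀ {x y} → (∃[ j ] (j < 1 × y ≡ x + (j + suc a))) → ⊥ ⊎ y ≡ x + suc a
  window⇒ (0 , _ , y≡) = inj₂ y≡
  window⇒ (suc _ , s≤s () , _)
  ⇒window : ∀ {x y} → ⊥ ⊎ y ≡ x + suc a → ∃[ j ] (j < 1 × y ≡ x + (j + suc a))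
  ⇒window (inj₂ y≡) = 0 , s≤s z≤n , y≡

cycPowCompl-TRVG-2a+3 : ∀ {a} → IsTRVG (CycPowCompl (suc (a + a) + 2) a)
cycPowCompl-TRVG-2a+3 {a} =
  cycPowCompl-representations⇒TRVG
    (matching (pairing-bound (s≤s (s≤s z≤n)))) (chains (chaining-bound (s≤s (s≤s z≤n))))
    (λ _ _ y≡x+2+a y≡x+1+a → distinct-distances (ℕ.n<1+n (suc a)) y≡x+1+a y≡x+2+a)
    (λ _ _ → ⇔.trans far⇔window (mk⇔ window⇒ ⇒window))
  where
  window⇒ : ∀ {x y} → (∃[ j ] (j < 2 × y ≡ x + (j + suc a))) → y ≡ x + suc (suc a) ⊎ y ≡ x + suc a
  window⇒ (0 , _ , y≡) = inj₂ y≡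
  window⇒ (1 , _ , y≡) = inj₁ y≡
  window⇒ (suc (suc _) , s≤s (s≤s ()) , _)
  ⇒window : ∀ {x y} → y ≡ x + suc (suc a) ⊎ y ≡ x + suc a → ∃[ j ] (j < 2 × y ≡ x + (j + suc a))
  ⇒window (inj₁ y≡) = 1 , s≤s (s≤s z≤n) , y≡
  ⇒window (inj₂ y≡) = 0 , s≤s z≤n , y≡

cycPowCompl-TRVG-2a+4 : ∀ {a} → 1 ≤ a → IsTRVG (CycPowCompl (suc (a + a) + 3) a)
cycPowCompl-TRVG-2a+4 {a} 1≤a =
  cycPowCompl-representations⇒TRVG
    (zigzag (pairing-bound ℕ.≤-refl)) (chains (chaining-bound (s≤s (s≤s 1≤a))))
    disjoint (λ _ _ → ⇔.trans far⇔window (mk⇔ window⇒ ⇒window))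
  where
  disjoint : ∀ {x y} → x < y → y < _ → y ≡ x + suc (suc a) ⊎ y ≡ x + suc (suc (suc a)) → y ≡ x + suc a → ⊥
  disjoint _ _ (inj₁ y≡x+2+a) y≡x+1+a = distinct-distances (ℕ.n<1+n (suc a)) y≡x+1+a y≡x+2+a
  disjoint _ _ (inj₂ y≡x+3+a) y≡x+1+a =
    distinct-distances (ℕ.m<n⇒m<1+n (ℕ.n<1+n (suc a))) y≡x+1+a y≡x+3+a
  window⇒ : ∀ {x y} → (∃[ j ] (j < 3 × y ≡ x + (j + suc a))) →
            (y ≡ x + suc (suc a) ⊎ y ≡ x + suc (suc (suc a))) ⊎ y ≡ x + suc a
  window⇒ (0 , _ , y≡) = inj₂ y≡
  window⇒ (1 , _ , y≡) = inj₁ (inj₁ y≡)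
  window⇒ (2 , _ , y≡) = inj₁ (inj₂ y≡)
  window⇒ (suc (suc (suc _)) , s≤s (s≤s (s≤s ())) , _)
  ⇒window : ∀ {x y} → (y ≡ x + suc (suc a) ⊎ y ≡ x + suc (suc (suc a))) ⊎ y ≡ x + suc a →
            ∃[ j ] (j < 3 × y ≡ x + (j + suc a))
  ⇒window (inj₁ (inj₁ y≡)) = 1 , s≤s (s≤s z≤n) , y≡
  ⇒window (inj₁ (inj₂ y≡)) = 2 , s≤s (s≤s (s≤s z≤n)) , y≡
  ⇒window (inj₂ y≡) = 0 , s≤s z≤n , y≡

cycPowCompl-TRVG-≤2a+4 : ∀ {n a} → 1 ≤ a → n ≤ 2 * a + 4 → IsTRVG (CycPowCompl n a)
cycPowCompl-TRVG-≤2a+4 {n} {a} 1≤a n≤2a+4 with ℕ.≤-total n (suc (a + a))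
... | inj₁ n≤2a+1 = cycPowCompl-TRVG-≤2a+1 n≤2a+1
... | inj₂ 2a+1≤n with ℕ.m≤n⇒∃[o]m+o≡n 2a+1≤n
...   | t , refl = by-width t (ℕ.+-cancelˡ-≤ (suc (a + a)) t 3 (ℕ.≤-trans n≤2a+4 (ℕ.≤-reflexive (shuffle a))))
  where
  shuffle : ∀ a → 2 * a + 4 ≡ suc (a + a) + 3
  shuffle = solve-∀
  by-width : ∀ t → t ≤ 3 → IsTRVG (CycPowCompl (suc (a + a) + t) a)
  by-width 0 _ = cycPowCompl-TRVG-≤2a+1 (ℕ.≤-reflexive (ℕ.+-identityʳ _))
  by-width 1 _ = cycPowCompl-TRVG-2a+2
  by-width 2 _ = cycPowCompl-TRVG-2a+3
  by-width 3 _ = cycPowCompl-TRVG-2a+4 1≤a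
  by-width (suc (suc (suc (suc _)))) (s≤s (s≤s (s≤s ())))

theorem1p6 : (n a : ℕ) → 3 ≤ n → 1 ≤ a →
    IsTRVG (CycPow n a)
    × IsTRVG (CycPowCompl n 1)
    × (3 ≤ a → 2 * a + 8 ≤ n → ¬ IsTRVG (CycPowCompl n a))
    × (2 ≤ a → n ≤ 2 * a + 4 → IsTRVG (CycPowCompl n a))
theorem1p6 n a 3≤n 1≤a =
  cycPow-TRVG n a ,
  cycPowCompl-1-TRVG 3≤n ,
  cycPowCompl-not-TRVG ,
  λ _ → cycPowCompl-TRVG-≤2a+4 1≤a
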